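{- Let $t\in\mathbb{Z}^+$ and let $\mathrm{Alg}$ be a deterministic $(\alpha,\beta,\gamma)$-competitive algorithm for $\mathrm{ASG}_t$ with respect to $(\mu_0,\mu_1)$. If $\alpha < t$, then $\gamma \geq 1$.
   Context: Online $(1,t)$-Asymmetric String Guessing with Unknown History and Predictions ($\mathrm{ASG}_t$), $t\in\mathbb{Z}^+$: an instance is a triple $I=(x,\hat{x},r)$ where $x,\hat x\in\{0,1\}^n$ and $r=\langle r_1,\dots,r_n\rangle$. Each request $r_i$ is a prompt to irrevocably output a bit $y_i$; together with $r_i$ the prediction bit $\hat{x}_i$ is revealed; $x$ is revealed only after the last request. Cost: $\mathrm{Alg}(I)=\sum_{i=1}^n\big(y_i+t\,x_i(1-y_i)\big)$, and $\mathrm{Opt}(I)=\sum_i x_i$. Error measures: $\mu_0(I)=\sum_{i} x_i(1-\hat{x}_i)$, $\mu_1(I)=\sum_{i} (1-x_i)\hat{x}_i$. An algorithm is $(\alpha,\beta,\gamma)$-competitive with respect to $(\mu_0,\mu_1)$ if there is a constant $\kappa$ such that for all instances $I$, $\mathrm{Alg}(I)\le \alpha\,\mathrm{Opt}(I)+\beta\,\mu_0(I)+\gamma\,\mu_1(I)+\kappa$, with $\alpha,\beta,\gamma\ge 0$.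
   Formalization: The parameters α, β, γ and the additive constant κ in the definition of (α,β,γ)-competitiveness are taken to be rational. -}

module Defs where

open import Data.Bool using (Bool; true; false)
open import Data.Nat using (ℕ; zero; suc; _+_)
open import Data.Integer using (+_)
open import Data.List using (List; []; _∷_; _++_; [_])
open import Data.Product using (_×_; _,_; ∃-syntax)
open import Data.Rational using (ℚ; _/_; _≤_)
import Data.Rational as Q

ℕ→ℚ : ℕ → ℚ
ℕ→ℚ n = + n / 1

-- An instance of ASG_t: a list of requests, the i-th request carrying the
-- pair (x_i , x̂_i) of the true bit and the predicted bit.  n = length.
Instance : Set
Instance = List (Bool × Bool)

-- A deterministic online algorithm with unknown history: when answering
-- request i it has seen exactly the predictions x̂_1,…,x̂_i (in order);
-- its earlier outputs are determined by these, and x is never revealed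
-- before the end.  So it is a function from the prediction prefix to y_i.
Algorithm : Set
Algorithm = List Bool → Bool

-- cost of answering y when the true bit is x: y + t·x·(1−y)
stepCost : ℕ → Bool → Bool → ℕ
stepCost t true  _     = 1
stepCost t false true  = t
stepCost t false false = 0

runCost : ℕ → Algorithm → List Bool → Instance → ℕ
runCost t A h [] = 0
runCost t A h ((x , p) ∷ rest) =
  stepCost t (A (h ++ [ p ])) x + runCost t A (h ++ [ p ]) rest

algCost : ℕ → Algorithm → Instance → ℕ
algCost t A I = runCost t A [] I

opt : Instance → ℕ
opt [] = 0
opt ((true , _) ∷ rest) = suc (opt rest)
opt ((false , _) ∷ rest) = opt rest

μ₀ : Instance → ℕ
μ₀ [] = 0
μ₀ ((true , false) ∷ rest) = suc (μ₀ rest)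
μ₀ (_ ∷ rest) = μ₀ rest

μ₁ : Instance → ℕ
μ₁ [] = 0
μ₁ ((false , true) ∷ rest) = suc (μ₁ rest)
μ₁ (_ ∷ rest) = μ₁ rest

Competitive : ℕ → Algorithm → ℚ → ℚ → ℚ → Set
Competitive t A α β γ =
  (Q.0ℚ ≤ α) × (Q.0ℚ ≤ β) × (Q.0ℚ ≤ γ) ×
  (∃[ κ ] ∀ (I : Instance) →
     ℕ→ℚ (algCost t A I)
       ≤ α Q.* ℕ→ℚ (opt I) Q.+ β Q.* ℕ→ℚ (μ₀ I) Q.+ γ Q.* ℕ→ℚ (μ₁ I) Q.+ κ)

{-# OPTIONS --safe #-}
-- Proof idea: the adversary always predicts 1 and reveals the true bit as
-- the opposite of the algorithm's answer.  Then every answer 1 is a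
-- μ₁-error costing 1 and every answer 0 is a miss costing t while adding
-- 1 to Opt, and μ₀ = 0.  Over n requests the competitive inequality
-- leaves (1 − γ)·μ₁ + (t − α)·Opt ≤ κ with μ₁ + Opt = n; if γ < 1 and
-- α < t both coefficients are at least ε = (1 − γ) ⊓ (t − α) > 0, so
-- ε·n ≤ κ for every n, which is absurd.
module Submission where

open import Defs
open import Data.Nat using (ℕ; _≤_)
open import Data.Rational using (ℚ; _<_; 1ℚ)
import Data.Rational as Q

open import Data.Bool using (Bool; true; false; not)
open import Data.List using (List; []; _∷_; _++_; [_])
open import Data.Nat using (zero; suc; _+_; _*_)
import Data.Nat.Properties as ℕ
open import Data.Nat.Coprimality using (1-coprimeTo) renaming (sym to coprime-sym)
open import Data.Nat.Tactic.RingSolver using (solve-∀)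
open import Data.Integer as ℤ using (+_; -[1+_]; ∣_∣)
import Data.Integer.Properties as ℤ
open import Data.Rational using (0ℚ; mkℚ; _⊓_; 1/_; Positive; NonZero; NonNegative)
import Data.Rational.Properties as ℚ
open import Data.Rational.Solver using (module +-*-Solver)
open import Data.Product using (_,_; ∃-syntax)
open import Data.Sum using (inj₁; inj₂)
open import Relation.Nullary using (¬_; yes; no)
open import Data.Empty using (⊥-elim)
open import Relation.Binary.PropositionalEquality
  using (_≡_; refl; sym; cong; cong₂; subst; subst₂; trans; module ≡-Reasoning)

adversary : Algorithm → List Bool → ℕ → Instance
adversary A h zero    = []
adversary A h (suc n) =
  (not (A (h ++ [ true ])) , true) ∷ adversary A (h ++ [ true ]) n

μ₀-adversary : ∀ A h n → μ₀ (adversary A h n) ≡ 0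
μ₀-adversary A h zero = refl
μ₀-adversary A h (suc n) with A (h ++ [ true ])
... | true  = μ₀-adversary A (h ++ [ true ]) n
... | false = μ₀-adversary A (h ++ [ true ]) n

μ₁+opt-adversary : ∀ A h n → μ₁ (adversary A h n) + opt (adversary A h n) ≡ n
μ₁+opt-adversary A h zero = refl
μ₁+opt-adversary A h (suc n) with A (h ++ [ true ])
... | true  = cong suc (μ₁+opt-adversary A (h ++ [ true ]) n)
... | false = trans (ℕ.+-suc _ _) (cong suc (μ₁+opt-adversary A (h ++ [ true ]) n))

runCost-adversary : ∀ t A h n →
  runCost t A h (adversary A h n) ≡ μ₁ (adversary A h n) + t * opt (adversary A h n)
runCost-adversary t A h zero = sym (ℕ.*-zeroʳ t)
runCost-adversary t A h (suc n) with A (h ++ [ true ])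
... | true  = cong suc (runCost-adversary t A (h ++ [ true ]) n)
... | false = trans (cong (λ c → t + c) (runCost-adversary t A (h ++ [ true ]) n))
                    (miss-cost t (μ₁ rest) (opt rest))
  where
  rest : Instance
  rest = adversary A (h ++ [ true ]) n
  miss-cost : ∀ t k m → t + (k + t * m) ≡ k + t * suc m
  miss-cost = solve-∀

-- _/_ normalises through a gcd that does not reduce on a variable n; in
-- normal form the arithmetic of ℚ computes.
ℕ→ℚ≡mkℚ : ∀ n → ℕ→ℚ n ≡ mkℚ (+ n) 0 (coprime-sym (1-coprimeTo n))
ℕ→ℚ≡mkℚ n = ℚ.↥p/↧p≡p (mkℚ (+ n) 0 (coprime-sym (1-coprimeTo n)))

ℕ→ℚ-homo-+ : ∀ m n → ℕ→ℚ (m + n) ≡ ℕ→ℚ m Q.+ ℕ→ℚ n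
ℕ→ℚ-homo-+ m n rewrite ℕ→ℚ≡mkℚ m | ℕ→ℚ≡mkℚ n =
  cong (Q._/ 1) (cong₂ ℤ._+_ (sym (ℤ.*-identityʳ (+ m))) (sym (ℤ.*-identityʳ (+ n))))

ℕ→ℚ-homo-* : ∀ m n → ℕ→ℚ (m * n) ≡ ℕ→ℚ m Q.* ℕ→ℚ n
ℕ→ℚ-homo-* m n rewrite ℕ→ℚ≡mkℚ m | ℕ→ℚ≡mkℚ n = cong (Q._/ 1) (ℤ.pos-* m n)

ℕ→ℚ-nonNeg : ∀ n → NonNegative (ℕ→ℚ n)
ℕ→ℚ-nonNeg n rewrite ℕ→ℚ≡mkℚ n = _

ℕ→ℚ-unbounded : ∀ p → ∃[ n ] p < ℕ→ℚ n
ℕ→ℚ-unbounded p@(mkℚ z d _) = suc ∣ z ∣ , p<n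
  where
  z<[1+∣z∣]*[1+d] : ∀ z → z ℤ.< + (suc ∣ z ∣ * suc d)
  z<[1+∣z∣]*[1+d] (+ m)    = ℤ.+<+ (ℕ.<-≤-trans (ℕ.n<1+n m) (ℕ.m≤m*n (suc m) (suc d)))
  z<[1+∣z∣]*[1+d] -[1+ m ] = ℤ.-<+
  p<n : p < ℕ→ℚ (suc ∣ z ∣)
  p<n rewrite ℕ→ℚ≡mkℚ (suc ∣ z ∣) =
    Q.*<* (subst (ℤ._< + (suc ∣ z ∣ * suc d)) (sym (ℤ.*-identityʳ z)) (z<[1+∣z∣]*[1+d] z))

archimedean : ∀ ε .{{_ : Positive ε}} p → ∃[ n ] p < ε Q.* ℕ→ℚ n
archimedean ε p = scale (ℕ→ℚ-unbounded (p Q.* 1/ ε))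
  where
  open ℚ.≤-Reasoning
  instance
    ε-nonZero : NonZero ε
    ε-nonZero = ℚ.pos⇒nonZero ε
  ε*[p*1/ε]≡p : ε Q.* (p Q.* 1/ ε) ≡ p
  ε*[p*1/ε]≡p = begin-equality
    ε Q.* (p Q.* 1/ ε)   ≡⟨ cong (ε Q.*_) (ℚ.*-comm p (1/ ε)) ⟩
    ε Q.* (1/ ε Q.* p)   ≡⟨ ℚ.*-assoc ε (1/ ε) p ⟨
    ε Q.* 1/ ε Q.* p     ≡⟨ cong (Q._* p) (ℚ.*-inverseʳ ε) ⟩
    1ℚ Q.* p             ≡⟨ ℚ.*-identityˡ p ⟩
    p                    ∎
  scale : ∃[ n ] p Q.* 1/ ε < ℕ→ℚ n → ∃[ n ] p < ε Q.* ℕ→ℚ n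
  scale (n , p/ε<n) = n , (begin-strict
    p                    ≡⟨ ε*[p*1/ε]≡p ⟨
    ε Q.* (p Q.* 1/ ε)   <⟨ ℚ.*-monoʳ-<-pos ε p/ε<n ⟩
    ε Q.* ℕ→ℚ n          ∎)

p<q⇒0<q-p : ∀ {p q} → p < q → 0ℚ < q Q.- p
p<q⇒0<q-p {p} {q} p<q = subst (_< q Q.- p) (ℚ.+-inverseʳ p) (ℚ.+-monoˡ-< (Q.- p) p<q)

⊓-glb-< : ∀ {p q r} → r < p → r < q → r < p ⊓ q
⊓-glb-< {p} {q} {r} r<p r<q with ℚ.⊓-sel p q
... | inj₁ p⊓q≡p = subst (r <_) (sym p⊓q≡p) r<p
... | inj₂ p⊓q≡q = subst (r <_) (sym p⊓q≡q) r<q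

slack-bound : ∀ {c α γ κ ε} K M .{{_ : NonNegative K}} .{{_ : NonNegative M}} →
  ε Q.≤ 1ℚ Q.- γ → ε Q.≤ c Q.- α →
  K Q.+ c Q.* M Q.≤ α Q.* M Q.+ γ Q.* K Q.+ κ →
  ε Q.* (K Q.+ M) Q.≤ κ
slack-bound {c} {α} {γ} {κ} {ε} K M ε≤1-γ ε≤c-α cost≤bound = begin
  ε Q.* (K Q.+ M)                               ≡⟨ ℚ.*-distribˡ-+ ε K M ⟩
  ε Q.* K Q.+ ε Q.* M                           ≤⟨ ℚ.+-mono-≤ (ℚ.*-monoʳ-≤-nonNeg K ε≤1-γ)
                                                                (ℚ.*-monoʳ-≤-nonNeg M ε≤c-α) ⟩
  (1ℚ Q.- γ) Q.* K Q.+ (c Q.- α) Q.* M          ≡⟨ slack≡cost-benchmark c α γ K M ⟩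
  (K Q.+ c Q.* M) Q.- benchmark                 ≤⟨ ℚ.+-monoˡ-≤ (Q.- benchmark) cost≤bound ⟩
  (benchmark Q.+ κ) Q.- benchmark               ≡⟨ +-cancel benchmark κ ⟩
  κ                                             ∎
  where
  open ℚ.≤-Reasoning
  open +-*-Solver
  benchmark : ℚ
  benchmark = α Q.* M Q.+ γ Q.* K
  slack≡cost-benchmark : ∀ c α γ K M →
    (1ℚ Q.- γ) Q.* K Q.+ (c Q.- α) Q.* M ≡ (K Q.+ c Q.* M) Q.- (α Q.* M Q.+ γ Q.* K)
  slack≡cost-benchmark = solve 5 (λ c α γ K M →
    (con 1ℚ :- γ) :* K :+ (c :- α) :* M := (K :+ c :* M) :- (α :* M :+ γ :* K)) refl
  +-cancel : ∀ a b → (a Q.+ b) Q.- a ≡ b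
  +-cancel = solve 2 (λ a b → (a :+ b) :- a := b) refl

no-uniform-bound : ∀ ε .{{_ : Positive ε}} κ → ¬ (∀ n → ε Q.* ℕ→ℚ n Q.≤ κ)
no-uniform-bound ε κ εn≤κ with archimedean ε κ
... | n , κ<εn = ℚ.<-irrefl refl (ℚ.<-≤-trans κ<εn (εn≤κ n))

adversary-bound : ∀ {t A α β γ κ ε} →
  (∀ I → ℕ→ℚ (algCost t A I)
           Q.≤ α Q.* ℕ→ℚ (opt I) Q.+ β Q.* ℕ→ℚ (μ₀ I) Q.+ γ Q.* ℕ→ℚ (μ₁ I) Q.+ κ) →
  ε Q.≤ 1ℚ Q.- γ → ε Q.≤ ℕ→ℚ t Q.- α →
  ∀ n → ε Q.* ℕ→ℚ n Q.≤ κ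
adversary-bound {t} {A} {α} {β} {γ} {κ} {ε} bounded ε≤1-γ ε≤t-α n =
  subst (λ x → ε Q.* x Q.≤ κ) K+M≡n
    (slack-bound {ℕ→ℚ t} {α} {γ} {κ} K M {{ℕ→ℚ-nonNeg (μ₁ I)}} {{ℕ→ℚ-nonNeg (opt I)}}
       ε≤1-γ ε≤t-α (subst₂ Q._≤_ algCost≡ bound≡ (bounded I)))
  where
  open ≡-Reasoning
  I : Instance
  I = adversary A [] n
  K M : ℚ
  K = ℕ→ℚ (μ₁ I)
  M = ℕ→ℚ (opt I)
  K+M≡n : K Q.+ M ≡ ℕ→ℚ n
  K+M≡n = trans (sym (ℕ→ℚ-homo-+ (μ₁ I) (opt I))) (cong ℕ→ℚ (μ₁+opt-adversary A [] n))
  algCost≡ : ℕ→ℚ (algCost t A I) ≡ K Q.+ ℕ→ℚ t Q.* M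
  algCost≡ = begin
    ℕ→ℚ (algCost t A I)              ≡⟨ cong ℕ→ℚ (runCost-adversary t A [] n) ⟩
    ℕ→ℚ (μ₁ I + t * opt I)           ≡⟨ ℕ→ℚ-homo-+ (μ₁ I) (t * opt I) ⟩
    K Q.+ ℕ→ℚ (t * opt I)            ≡⟨ cong (K Q.+_) (ℕ→ℚ-homo-* t (opt I)) ⟩
    K Q.+ ℕ→ℚ t Q.* M                ∎
  bound≡ : α Q.* M Q.+ β Q.* ℕ→ℚ (μ₀ I) Q.+ γ Q.* K Q.+ κ ≡ α Q.* M Q.+ γ Q.* K Q.+ κ
  bound≡ = begin
    α Q.* M Q.+ β Q.* ℕ→ℚ (μ₀ I) Q.+ γ Q.* K Q.+ κ
      ≡⟨ cong (λ m → α Q.* M Q.+ β Q.* ℕ→ℚ m Q.+ γ Q.* K Q.+ κ) (μ₀-adversary A [] n) ⟩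
    α Q.* M Q.+ β Q.* 0ℚ Q.+ γ Q.* K Q.+ κ
      ≡⟨ cong (λ x → α Q.* M Q.+ x Q.+ γ Q.* K Q.+ κ) (ℚ.*-zeroʳ β) ⟩
    α Q.* M Q.+ 0ℚ Q.+ γ Q.* K Q.+ κ
      ≡⟨ cong (λ x → x Q.+ γ Q.* K Q.+ κ) (ℚ.+-identityʳ (α Q.* M)) ⟩
    α Q.* M Q.+ γ Q.* K Q.+ κ
      ∎

lemma12 : (t : ℕ) → 1 ≤ t → (A : Algorithm) → (α β γ : ℚ) →
    Competitive t A α β γ → α < ℕ→ℚ t → 1ℚ Q.≤ γ
lemma12 t _ A α β γ (_ , _ , _ , κ , bounded) α<t with 1ℚ ℚ.≤? γ
... | yes 1≤γ = 1≤γ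
... | no 1≰γ = ⊥-elim (no-uniform-bound ε κ
                 (adversary-bound {t} {A} {α} {β} {γ} {κ} bounded
                    (ℚ.p⊓q≤p _ _) (ℚ.p⊓q≤q (1ℚ Q.- γ) _)))
  where
  ε : ℚ
  ε = (1ℚ Q.- γ) ⊓ (ℕ→ℚ t Q.- α)
  instance
    ε-pos : Positive ε
    ε-pos = Q.positive (⊓-glb-< (p<q⇒0<q-p (ℚ.≰⇒> 1≰γ)) (p<q⇒0<q-p α<t))
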